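{- Let $r\geq 2$ be an integer, $C>1$ and $0<\varepsilon<1$ real numbers. There exist $\delta_0>0$ and $n_0$ (depending on $r,C,\varepsilon$) such that for all $0<\delta\le\delta_0$ and $n\ge n_0$ the following holds. Let $A_1, \dots, A_r$ be subsets of an abelian group $\mathbf{G}$ with $\lvert A_1 \rvert = \cdots = \lvert A_r \rvert = n$, and $H \subseteq A_1 \times \cdots \times A_r$ an $r$-partite $r$-uniform hypergraph with $\lvert E(H) \rvert \geq (1 - \delta)n^r$ and $\left\lvert \bigoplus_H (A_1, \dots, A_r) \right\rvert \leq C n$. Then for each $i\in [r]$ there exists $A'_i \subseteq A_i$ such that (1) $\lvert A'_i\rvert = \lceil (1 - \varepsilon)n \rceil$ for each $i\in [r]$, and (2) $\lvert A_1' + \cdots + A_r'\rvert \leq 2 C^{2r-1} n$.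
   Context: $H$ is a set of ordered tuples $(a_1,\dots,a_r)$ with $a_i\in A_i$, and $\bigoplus_H (A_1, \dots, A_r) \coloneqq \{\sum_{i} a_i : (a_1, \dots, a_r) \in E(H)\}$. The paper states the hypothesis as "$0<\frac1n,\delta\ll\frac1C,\frac1r,\varepsilon<1$", meaning $\delta$ sufficiently small and $n$ sufficiently large in terms of $C,r,\varepsilon$.
   Formalization: The parameters C, ε and δ range over the rationals rather than the reals, and the threshold δ₀ is taken in the rationals. -}

module Defs where

open import Level using (Level)
open import Data.Nat as ℕ using (ℕ; zero; suc)
open import Data.Integer using (+_)
open import Data.Rational as ℚ using (ℚ; 1ℚ; _*_)
open import Data.Fin using (Fin)
open import Data.Vec using (Vec; lookup)
open import Data.List using (List; length)
open import Data.Product using (∃; _×_)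
open import Algebra.Bundles using (AbelianGroup)

toℚ : ℕ → ℚ
toℚ n = (+ n) ℚ./ 1

_^ℚ_ : ℚ → ℕ → ℚ
q ^ℚ zero = 1ℚ
q ^ℚ suc k = q * (q ^ℚ k)

module _ {c ℓ : Level} (G : AbelianGroup c ℓ) where
  open AbelianGroup G

  gsum : {r : ℕ} → (Fin r → Carrier) → Carrier
  gsum {zero} g = ε
  gsum {suc r} g = g Fin.zero ∙ gsum (λ i → g (Fin.suc i))
    where import Data.Fin as Fin

  -- the set S = { x : P x } of group elements has at most m elements
  -- (up to the group's equality ≈): it is covered by a list of length m.
  AtMost : {p : Level} (P : Carrier → Set p) → ℕ → Set (c Level.⊔ ℓ Level.⊔ p)
  AtMost P m = ∃ λ (L : List Carrier) → (length L ℕ.≤ m) ×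
                 (∀ x → P x → x ∈ L)
    where open import Data.List.Membership.Setoid setoid using (_∈_)

-- Write X = n^r and call a vertex a of part j typical when 4r·d ≤ X, where d is the number of
-- tuples b for which b[j ↦ a] is not an edge. Summed over a, these numbers give n times the number
-- of non-edges, which density makes at most εX/(4r); so by Markov's inequality at most εn vertices
-- of each part are atypical, and A′ⱼ can consist of ⌈(1-ε)n⌉ typical vertices.
-- For a tuple t of typical vertices at least X/2 tuples b are anchors: b and every b[j ↦ tⱼ] are
-- edges. The signature of an anchor records where the sums of b and of the b[j ↦ tⱼ] occur in the
-- list of at most Cn edge sums. It determines b, as each Aⱼ is injective, and it determines the sum
-- of t, as Σⱼ Σ(b[j ↦ tⱼ]) + Σb = r·Σb + Σt. Tuples with different sums thus have disjoint sets of
-- at least X/2 signatures among (Cn)^(r+1), so a greedy choice of tuples with pairwise disjoint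
-- signature sets gives at most 2(Cn)^(r+1)/X ≤ 2C^(2r-1)n representatives of all sums over A′.

module Submission where

module Estimates where

  open import Defs
  open import Data.Nat as ℕ using (ℕ; zero; suc)
  import Data.Nat.Properties as ℕ
  open import Data.Integer as ℤ using (ℤ; +_)
  import Data.Integer.Properties as ℤ
  open import Data.Integer.DivMod using (a≡a%n+[a/n]*n; n%d<d)
  open import Data.Rational as ℚ using (ℚ; mkℚ; 0ℚ; 1ℚ; _<_; _≤_; _*_; _-_; _+_; ceiling; ↥_; ↧_; ↧ₙ_)
  import Data.Rational.Properties as ℚ
  open import Data.Rational.Unnormalised as ℚᵘ using (ℚᵘ; mkℚᵘ; *≡*; *≤*; *<*) renaming (_≃_ to _≃ᵘ_)
  import Data.Rational.Unnormalised.Properties as ℚᵘ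
  open import Data.Product using (∃; _×_; _,_; proj₁; proj₂)
  open import Relation.Binary.PropositionalEquality
  open import Algebra.Bundles using (CommutativeMonoid)

  fromℕᵘ : ℕ → ℚᵘ
  fromℕᵘ n = mkℚᵘ (+ n) 0

  toℚᵘ-toℚ : ∀ n → ℚ.toℚᵘ (toℚ n) ≃ᵘ fromℕᵘ n
  toℚᵘ-toℚ n = ℚ.toℚᵘ-fromℚᵘ (fromℕᵘ n)

  toℚ-homo-+ : ∀ a b → toℚ (a ℕ.+ b) ≡ toℚ a + toℚ b
  toℚ-homo-+ a b = ℚ.toℚᵘ-injective (begin
    ℚ.toℚᵘ (toℚ (a ℕ.+ b))                   ≈⟨ toℚᵘ-toℚ (a ℕ.+ b) ⟩
    fromℕᵘ (a ℕ.+ b)                         ≈⟨ *≡* cross ⟩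
    fromℕᵘ a ℚᵘ.+ fromℕᵘ b                   ≈⟨ ℚᵘ.+-cong (toℚᵘ-toℚ a) (toℚᵘ-toℚ b) ⟨
    ℚ.toℚᵘ (toℚ a) ℚᵘ.+ ℚ.toℚᵘ (toℚ b)       ≈⟨ ℚ.toℚᵘ-homo-+ (toℚ a) (toℚ b) ⟨
    ℚ.toℚᵘ (toℚ a + toℚ b)                   ∎)
    where
    open ℚᵘ.≃-Reasoning
    cross : + (a ℕ.+ b) ℤ.* + 1 ≡ (+ a ℤ.* + 1 ℤ.+ + b ℤ.* + 1) ℤ.* + 1
    cross rewrite ℤ.*-identityʳ (+ a) | ℤ.*-identityʳ (+ b) | ℤ.*-identityʳ (+ (a ℕ.+ b)) = ℤ.pos-+ a b

  toℚ-homo-* : ∀ a b → toℚ (a ℕ.* b) ≡ toℚ a * toℚ b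
  toℚ-homo-* a b = ℚ.toℚᵘ-injective (begin
    ℚ.toℚᵘ (toℚ (a ℕ.* b))                   ≈⟨ toℚᵘ-toℚ (a ℕ.* b) ⟩
    fromℕᵘ (a ℕ.* b)                         ≈⟨ *≡* cross ⟩
    fromℕᵘ a ℚᵘ.* fromℕᵘ b                   ≈⟨ ℚᵘ.*-cong (toℚᵘ-toℚ a) (toℚᵘ-toℚ b) ⟨
    ℚ.toℚᵘ (toℚ a) ℚᵘ.* ℚ.toℚᵘ (toℚ b)       ≈⟨ ℚ.toℚᵘ-homo-* (toℚ a) (toℚ b) ⟨
    ℚ.toℚᵘ (toℚ a * toℚ b)                   ∎)
    where
    open ℚᵘ.≃-Reasoning
    cross : + (a ℕ.* b) ℤ.* + 1 ≡ (+ a ℤ.* + b) ℤ.* + 1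
    cross rewrite ℤ.*-identityʳ (+ (a ℕ.* b)) | ℤ.*-identityʳ (+ a ℤ.* + b) = ℤ.pos-* a b

  toℚ-homo-^ : ∀ a k → toℚ (a ℕ.^ k) ≡ toℚ a ^ℚ k
  toℚ-homo-^ a zero    = refl
  toℚ-homo-^ a (suc k) = trans (toℚ-homo-* a (a ℕ.^ k)) (cong (toℚ a *_) (toℚ-homo-^ a k))

  toℚ-mono-≤ : ∀ {a b} → a ℕ.≤ b → toℚ a ≤ toℚ b
  toℚ-mono-≤ {a} {b} a≤b = ℚ.toℚᵘ-cancel-≤ (ℚᵘ.≤-respʳ-≃ (ℚᵘ.≃-sym (toℚᵘ-toℚ b))
    (ℚᵘ.≤-respˡ-≃ (ℚᵘ.≃-sym (toℚᵘ-toℚ a)) (*≤* (ℤ.*-monoʳ-≤-nonNeg (+ 1) (ℤ.+≤+ a≤b)))))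

  toℚ-cancel-≤ : ∀ {a b} → toℚ a ≤ toℚ b → a ℕ.≤ b
  toℚ-cancel-≤ {a} {b} p
    with *≤* q ← ℚᵘ.≤-respʳ-≃ (toℚᵘ-toℚ b) (ℚᵘ.≤-respˡ-≃ (toℚᵘ-toℚ a) (ℚ.toℚᵘ-mono-≤ p))
    rewrite ℤ.*-identityʳ (+ a) | ℤ.*-identityʳ (+ b) = ℤ.drop‿+≤+ q

  toℚ-cancel-< : ∀ {a b} → toℚ a < toℚ b → a ℕ.< b
  toℚ-cancel-< {a} {b} p
    with *<* q ← ℚᵘ.<-respʳ-≃ (toℚᵘ-toℚ b) (ℚᵘ.<-respˡ-≃ (toℚᵘ-toℚ a) (ℚ.toℚᵘ-mono-< p))
    rewrite ℤ.*-identityʳ (+ a) | ℤ.*-identityʳ (+ b) = ℤ.drop‿+<+ q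

  toℚ-nonNeg : ∀ n → 0ℚ ≤ toℚ n
  toℚ-nonNeg n = toℚ-mono-≤ {0} {n} ℕ.z≤n

  -- Negation on ℚ computes only once the sign of the numerator is known.
  -⌊-q⌋≡⌈q⌉ : ∀ q → ℤ.- (↥ (ℚ.- q) ℤ./ ↧ (ℚ.- q)) ≡ ceiling q
  -⌊-q⌋≡⌈q⌉ (mkℚ ℤ.+0       _ _) = refl
  -⌊-q⌋≡⌈q⌉ (mkℚ ℤ.+[1+ _ ] _ _) = refl
  -⌊-q⌋≡⌈q⌉ (mkℚ ℤ.-[1+ _ ] _ _) = refl

  ⌈q⌉*↧q≡rem+↥q : ∀ q → ∃ λ rem → rem ℕ.< ↧ₙ q × ceiling q ℤ.* ↧ q ≡ + rem ℤ.+ ↥ q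
  ⌈q⌉*↧q≡rem+↥q q = rem , rem<d , (begin
    ceiling q ℤ.* ↧ q                    ≡⟨ cong₂ ℤ._*_ (-⌊-q⌋≡⌈q⌉ q) (ℚ.↧-neg q) ⟨
    ℤ.- (a ℤ./ d) ℤ.* d                  ≡⟨ rearrange (+ rem) (a ℤ./ d) d ⟩
    + rem ℤ.+ ℤ.- (+ rem ℤ.+ (a ℤ./ d) ℤ.* d) ≡⟨ cong (λ x → + rem ℤ.+ ℤ.- x) (a≡a%n+[a/n]*n a d) ⟨
    + rem ℤ.+ ℤ.- a                      ≡⟨ cong (ℤ._+_ (+ rem)) (trans (cong ℤ.-_ (ℚ.↥-neg q)) (ℤ.neg-involutive (↥ q))) ⟩
    + rem ℤ.+ ↥ q                        ∎)
    where
    open ≡-Reasoning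
    open import Data.Integer.Tactic.RingSolver using (solve-∀)
    a = ↥ (ℚ.- q)
    d = ↧ (ℚ.- q)
    rem = a ℤ.% d
    rearrange : ∀ r x d → ℤ.- x ℤ.* d ≡ r ℤ.+ ℤ.- (r ℤ.+ x ℤ.* d)
    rearrange = solve-∀
    rem<d : rem ℕ.< ↧ₙ q
    rem<d = subst (rem ℕ.<_) (cong ℤ.∣_∣ (ℚ.↧-neg q)) (n%d<d a d)

  ceiling-nonNeg : ∀ q → 0ℚ ≤ q → ∃ λ k → + k ≡ ceiling q × toℚ k < q + 1ℚ
  ceiling-nonNeg q@(mkℚ num d-1 _) 0≤q = ℤ.∣ c ∣ , +∣c∣≡c , ℚ.toℚᵘ-cancel-<
    (ℚᵘ.<-respʳ-≃ (ℚᵘ.≃-sym (ℚ.toℚᵘ-homo-+ q 1ℚ))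
      (ℚᵘ.<-respˡ-≃ (ℚᵘ.≃-sym (toℚᵘ-toℚ ℤ.∣ c ∣)) (*<* cross)))
    where
    open ℤ.≤-Reasoning
    c = ceiling q
    d = ↧ q
    rem = proj₁ (⌈q⌉*↧q≡rem+↥q q)
    rem<d = proj₁ (proj₂ (⌈q⌉*↧q≡rem+↥q q))
    c*d≡rem+num = proj₂ (proj₂ (⌈q⌉*↧q≡rem+↥q q))
    0≤num : + 0 ℤ.≤ num
    0≤num = ℤ.≤-trans (ℚ.drop-*≤* 0≤q) (ℤ.≤-reflexive (ℤ.*-identityʳ num))
    +∣c∣≡c : + ℤ.∣ c ∣ ≡ c
    +∣c∣≡c = ℤ.0≤i⇒+∣i∣≡i (ℤ.*-cancelʳ-≤-pos (+ 0) c d (begin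
      + 0            ≤⟨ 0≤num ⟩
      num            ≤⟨ ℤ.i≤j+i num (+ rem) ⟩
      + rem ℤ.+ num  ≡⟨ c*d≡rem+num ⟨
      c ℤ.* d        ∎))
    cross : + ℤ.∣ c ∣ ℤ.* (d ℤ.* + 1) ℤ.< (num ℤ.* + 1 ℤ.+ + 1 ℤ.* d) ℤ.* + 1
    cross = begin-strict
      + ℤ.∣ c ∣ ℤ.* (d ℤ.* + 1)               ≡⟨ cong₂ ℤ._*_ +∣c∣≡c (ℤ.*-identityʳ d) ⟩
      c ℤ.* d                                 ≡⟨ c*d≡rem+num ⟩
      + rem ℤ.+ num                           <⟨ ℤ.+-monoˡ-< num (ℤ.+<+ rem<d) ⟩
      d ℤ.+ num                               ≡⟨ rearrange d num ⟩
      (num ℤ.* + 1 ℤ.+ + 1 ℤ.* d) ℤ.* + 1     ∎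
      where
      open import Data.Integer.Tactic.RingSolver using (solve-∀)
      rearrange : ∀ d n → d ℤ.+ n ≡ (n ℤ.* + 1 ℤ.+ + 1 ℤ.* d) ℤ.* + 1
      rearrange = solve-∀

  ^ℚ-distrib-* : ∀ x y k → (x * y) ^ℚ k ≡ (x ^ℚ k) * (y ^ℚ k)
  ^ℚ-distrib-* x y zero    = refl
  ^ℚ-distrib-* x y (suc k) = trans (cong ((x * y) *_) (^ℚ-distrib-* x y k)) (interchange x y (x ^ℚ k) (y ^ℚ k))
    where
    open import Algebra.Properties.CommutativeSemigroup
      (CommutativeMonoid.commutativeSemigroup ℚ.*-1-commutativeMonoid) using (interchange)

  ^ℚ-nonNeg : ∀ {x} k → 0ℚ ≤ x → 0ℚ ≤ x ^ℚ k
  ^ℚ-nonNeg zero    _   = ℚ.<⇒≤ (ℚ.positive⁻¹ 1ℚ)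
  ^ℚ-nonNeg {x} (suc k) 0≤x = ℚ.nonNegative⁻¹ _
    {{ℚ.nonNeg*nonNeg⇒nonNeg x {{ℚ.nonNegative 0≤x}} (x ^ℚ k) {{ℚ.nonNegative (^ℚ-nonNeg k 0≤x)}}}}

  ^ℚ-monoˡ-≤ : ∀ {x y} k → 0ℚ ≤ x → x ≤ y → x ^ℚ k ≤ y ^ℚ k
  ^ℚ-monoˡ-≤ zero    _   _   = ℚ.≤-refl
  ^ℚ-monoˡ-≤ {x} {y} (suc k) 0≤x x≤y = ℚ.≤-trans
    (ℚ.*-monoʳ-≤-nonNeg (x ^ℚ k) {{ℚ.nonNegative (^ℚ-nonNeg k 0≤x)}} x≤y)
    (ℚ.*-monoˡ-≤-nonNeg y {{ℚ.nonNegative (ℚ.≤-trans 0≤x x≤y)}} (^ℚ-monoˡ-≤ k 0≤x x≤y))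

  ^ℚ-monoʳ-≤ : ∀ {x} → 1ℚ ≤ x → ∀ {j k} → j ℕ.≤ k → x ^ℚ j ≤ x ^ℚ k
  ^ℚ-monoʳ-≤ {x} 1≤x {k = k} ℕ.z≤n = 1≤x^ k
    where
    instance _ = ℚ.nonNegative (ℚ.≤-trans (ℚ.<⇒≤ (ℚ.positive⁻¹ 1ℚ)) 1≤x)
    1≤x^ : ∀ k → 1ℚ ≤ x ^ℚ k
    1≤x^ zero    = ℚ.≤-refl
    1≤x^ (suc k) = ℚ.≤-trans 1≤x
      (ℚ.≤-trans (ℚ.≤-reflexive (sym (ℚ.*-identityʳ x))) (ℚ.*-monoˡ-≤-nonNeg x (1≤x^ k)))
  ^ℚ-monoʳ-≤ {x} 1≤x (ℕ.s≤s j≤k) = ℚ.*-monoˡ-≤-nonNeg x (^ℚ-monoʳ-≤ 1≤x j≤k)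
    where instance _ = ℚ.nonNegative (ℚ.≤-trans (ℚ.<⇒≤ (ℚ.positive⁻¹ 1ℚ)) 1≤x)

  toℚ-positive : ∀ c .{{_ : ℕ.NonZero c}} → ℚ.Positive (toℚ c)
  toℚ-positive c = ℚ.normalize-pos c 1

  rest≤δ*total : ∀ {δ} X h M → (1ℚ - δ) * toℚ X ≤ toℚ h → h ℕ.+ M ℕ.≤ X → toℚ M ≤ δ * toℚ X
  rest≤δ*total {δ} X h M dense h+M≤X = begin
    toℚ M                     ≡⟨ rearrange₁ (toℚ M) D ⟩
    (D + toℚ M) - D           ≤⟨ ℚ.+-monoˡ-≤ (ℚ.- D) (ℚ.+-monoˡ-≤ (toℚ M) dense) ⟩
    (toℚ h + toℚ M) - D       ≡⟨ cong (_- D) (toℚ-homo-+ h M) ⟨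
    toℚ (h ℕ.+ M) - D         ≤⟨ ℚ.+-monoˡ-≤ (ℚ.- D) (toℚ-mono-≤ h+M≤X) ⟩
    toℚ X - D                 ≡⟨ rearrange₂ δ (toℚ X) ⟩
    δ * toℚ X                 ∎
    where
    open ℚ.≤-Reasoning
    D = (1ℚ - δ) * toℚ X
    open import Data.Rational.Solver using (module +-*-Solver)
    open +-*-Solver
    rearrange₁ : ∀ m a → m ≡ (a + m) - a
    rearrange₁ = solve 2 (λ m a → m := (a :+ m) :- a) refl
    rearrange₂ : ∀ d x → x - (1ℚ - d) * x ≡ d * x
    rearrange₂ = solve 2 (λ d x → x :- (con 1ℚ :- d) :* x := d :* x) refl

  instance
    toℚ-nonZero : ∀ {c} .{{_ : ℕ.NonZero c}} → ℚ.NonZero (toℚ c)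
    toℚ-nonZero {c} = ℚ.pos⇒nonZero (toℚ c) {{toℚ-positive c}}

  _/ℕ_ : ℚ → (c : ℕ) → .{{_ : ℕ.NonZero c}} → ℚ
  ε /ℕ c = ε ℚ.÷ toℚ c

  *-÷-cancel : ∀ p q .{{_ : ℚ.NonZero p}} → p * (q ℚ.÷ p) ≡ q
  *-÷-cancel p q = begin
    p * (q * ℚ.1/ p)   ≡⟨ cong (p *_) (ℚ.*-comm q _) ⟩
    p * (ℚ.1/ p * q)   ≡⟨ ℚ.*-assoc p _ q ⟨
    p * ℚ.1/ p * q     ≡⟨ cong (_* q) (ℚ.*-inverseʳ p) ⟩
    1ℚ * q             ≡⟨ ℚ.*-identityˡ q ⟩
    q                  ∎
    where open ≡-Reasoning

  c*m≤ε*x : ∀ c .{{_ : ℕ.NonZero c}} {ε δ} X M → δ ≤ ε /ℕ c → toℚ M ≤ δ * toℚ X →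
            toℚ (c ℕ.* M) ≤ ε * toℚ X
  c*m≤ε*x c {ε} {δ} X M δ≤ε/c M≤δX = begin
    toℚ (c ℕ.* M)                    ≡⟨ toℚ-homo-* c M ⟩
    toℚ c * toℚ M                    ≤⟨ ℚ.*-monoˡ-≤-nonNeg (toℚ c) M≤δX ⟩
    toℚ c * (δ * toℚ X)              ≤⟨ ℚ.*-monoˡ-≤-nonNeg (toℚ c) (ℚ.*-monoʳ-≤-nonNeg (toℚ X) δ≤ε/c) ⟩
    toℚ c * ((ε ℚ.÷ toℚ c) * toℚ X)  ≡⟨ ℚ.*-assoc (toℚ c) _ (toℚ X) ⟨
    toℚ c * (ε ℚ.÷ toℚ c) * toℚ X    ≡⟨ cong (_* toℚ X) (*-÷-cancel (toℚ c) ε) ⟩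
    ε * toℚ X                        ∎
    where
    open ℚ.≤-Reasoning
    instance
      _ = ℚ.pos⇒nonNeg (toℚ c) {{toℚ-positive c}}
      _ = ℚ.normalize-nonNeg X 1

  toℚ≤ε*toℚ⇒≤ : ∀ {ε} a b → ε ≤ 1ℚ → toℚ a ≤ ε * toℚ b → a ℕ.≤ b
  toℚ≤ε*toℚ⇒≤ {ε} a b ε≤1 a≤εb = toℚ-cancel-≤ (begin
    toℚ a        ≤⟨ a≤εb ⟩
    ε * toℚ b    ≤⟨ ℚ.*-monoʳ-≤-nonNeg (toℚ b) ε≤1 ⟩
    1ℚ * toℚ b   ≡⟨ ℚ.*-identityˡ (toℚ b) ⟩
    toℚ b        ∎)
    where
    open ℚ.≤-Reasoning
    instance _ = ℚ.normalize-nonNeg b 1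

  x*b≤n*l⇒b≤ε*n : ∀ {ε} X n B L .{{_ : ℕ.NonZero X}} → X ℕ.* B ℕ.≤ n ℕ.* L → toℚ L ≤ ε * toℚ X →
                 toℚ B ≤ ε * toℚ n
  x*b≤n*l⇒b≤ε*n {ε} X n B L XB≤nL L≤εX = ℚ.*-cancelʳ-≤-pos (toℚ X) {{toℚ-positive X}} (begin
    toℚ B * toℚ X          ≡⟨ ℚ.*-comm (toℚ B) (toℚ X) ⟩
    toℚ X * toℚ B          ≡⟨ toℚ-homo-* X B ⟨
    toℚ (X ℕ.* B)          ≤⟨ toℚ-mono-≤ XB≤nL ⟩
    toℚ (n ℕ.* L)          ≡⟨ toℚ-homo-* n L ⟩
    toℚ n * toℚ L          ≤⟨ ℚ.*-monoˡ-≤-nonNeg (toℚ n) L≤εX ⟩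
    toℚ n * (ε * toℚ X)    ≡⟨ ℚ.*-assoc (toℚ n) ε (toℚ X) ⟨
    toℚ n * ε * toℚ X      ≡⟨ cong (_* toℚ X) (ℚ.*-comm (toℚ n) ε) ⟩
    ε * toℚ n * toℚ X      ∎)
    where
    open ℚ.≤-Reasoning
    instance _ = ℚ.normalize-nonNeg n 1

  fraction+ceiling≤ : ∀ {ε} n B k → toℚ B ≤ ε * toℚ n → toℚ k < (1ℚ - ε) * toℚ n + 1ℚ → B ℕ.+ k ℕ.≤ n
  fraction+ceiling≤ {ε} n B k B≤εn k<[1-ε]n+1 = ℕ.≤-pred (toℚ-cancel-< (begin-strict
    toℚ (B ℕ.+ k)                          ≡⟨ toℚ-homo-+ B k ⟩
    toℚ B + toℚ k                          <⟨ ℚ.+-mono-≤-< B≤εn k<[1-ε]n+1 ⟩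
    ε * toℚ n + ((1ℚ - ε) * toℚ n + 1ℚ)    ≡⟨ rearrange ε (toℚ n) ⟩
    1ℚ + toℚ n                             ≡⟨ toℚ-homo-+ 1 n ⟨
    toℚ (suc n)                            ∎))
    where
    open ℚ.≤-Reasoning
    open import Data.Rational.Solver using (module +-*-Solver)
    open +-*-Solver
    rearrange : ∀ e x → e * x + ((1ℚ - e) * x + 1ℚ) ≡ 1ℚ + x
    rearrange = solve 2 (λ e x → e :* x :+ ((con 1ℚ :- e) :* x :+ con 1ℚ) := con 1ℚ :+ x) refl

  power-count-bound : ∀ {C} r e n ℓ K .{{_ : ℕ.NonZero n}} → 1ℚ ≤ C → suc r ℕ.≤ e →
    n ℕ.^ r ℕ.* K ℕ.≤ 2 ℕ.* ℓ ℕ.^ suc r → toℚ ℓ ≤ C * toℚ n →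
    toℚ K ≤ toℚ 2 * (C ^ℚ e) * toℚ n
  power-count-bound {C} r e n ℓ K 1≤C r+1≤e count ℓ≤Cn = begin
    toℚ K                              ≤⟨ ℚ.*-cancelʳ-≤-pos N {{N-pos}} K*N≤ ⟩
    toℚ 2 * (C ^ℚ suc r) * toℚ n       ≤⟨ ℚ.*-monoʳ-≤-nonNeg (toℚ n)
                                            (ℚ.*-monoˡ-≤-nonNeg (toℚ 2) (^ℚ-monoʳ-≤ 1≤C r+1≤e)) ⟩
    toℚ 2 * (C ^ℚ e) * toℚ n           ∎
    where
    open ℚ.≤-Reasoning
    instance
      _ = ℚ.normalize-nonNeg n 1
      _ = ℚ.normalize-nonNeg 2 1
      _ = ℚ.normalize-nonNeg ℓ 1
    N = toℚ n ^ℚ r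
    N-pos : ℚ.Positive N
    N-pos = subst ℚ.Positive (toℚ-homo-^ n r) (toℚ-positive (n ℕ.^ r) {{ℕ.m^n≢0 n r}})
    K*N≤ : toℚ K * N ≤ toℚ 2 * (C ^ℚ suc r) * toℚ n * N
    K*N≤ = begin
      toℚ K * N                               ≡⟨ cong (toℚ K *_) (toℚ-homo-^ n r) ⟨
      toℚ K * toℚ (n ℕ.^ r)                   ≡⟨ ℚ.*-comm (toℚ K) _ ⟩
      toℚ (n ℕ.^ r) * toℚ K                   ≡⟨ toℚ-homo-* (n ℕ.^ r) K ⟨
      toℚ (n ℕ.^ r ℕ.* K)                     ≤⟨ toℚ-mono-≤ count ⟩
      toℚ (2 ℕ.* ℓ ℕ.^ suc r)                 ≡⟨ toℚ-homo-* 2 (ℓ ℕ.^ suc r) ⟩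
      toℚ 2 * toℚ (ℓ ℕ.^ suc r)               ≡⟨ cong (toℚ 2 *_) (toℚ-homo-^ ℓ (suc r)) ⟩
      toℚ 2 * (toℚ ℓ ^ℚ suc r)                ≤⟨ ℚ.*-monoˡ-≤-nonNeg (toℚ 2)
                                                   (^ℚ-monoˡ-≤ (suc r) (toℚ-nonNeg ℓ) ℓ≤Cn) ⟩
      toℚ 2 * ((C * toℚ n) ^ℚ suc r)          ≡⟨ cong (toℚ 2 *_) (^ℚ-distrib-* C (toℚ n) (suc r)) ⟩
      toℚ 2 * ((C ^ℚ suc r) * (toℚ n * N))    ≡⟨ rearrange (toℚ 2) (C ^ℚ suc r) (toℚ n) N ⟩
      toℚ 2 * (C ^ℚ suc r) * toℚ n * N        ∎
      where
      open import Data.Rational.Solver using (module +-*-Solver)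
      open +-*-Solver
      rearrange : ∀ t c x y → t * (c * (x * y)) ≡ t * c * x * y
      rearrange = solve 4 (λ t c x y → t :* (c :* (x :* y)) := t :* c :* x :* y) refl

  0</ℕ : ∀ {ε} c .{{_ : ℕ.NonZero c}} → 0ℚ < ε → 0ℚ < ε /ℕ c
  0</ℕ {ε} c 0<ε = ℚ.positive⁻¹ _
    {{ℚ.pos*pos⇒pos ε {{ℚ.positive 0<ε}} _ {{ℚ.1/pos⇒pos (toℚ c) {{toℚ-positive c}}}}}}

  0≤[1-ε]*toℚ : ∀ {ε} n → ε ≤ 1ℚ → 0ℚ ≤ (1ℚ - ε) * toℚ n
  0≤[1-ε]*toℚ {ε} n ε≤1 = ℚ.nonNegative⁻¹ _
    {{ℚ.nonNeg*nonNeg⇒nonNeg (1ℚ - ε) {{ℚ.nonNegative 0≤1-ε}} (toℚ n) {{ℚ.normalize-nonNeg n 1}}}}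
    where
    0≤1-ε : 0ℚ ≤ 1ℚ - ε
    0≤1-ε = ℚ.≤-trans (ℚ.≤-reflexive (sym (ℚ.+-inverseʳ ε))) (ℚ.+-monoˡ-≤ (ℚ.- ε) ε≤1)

module Counting where

  open import Level using (Level; _⊔_)
  open import Data.Nat as ℕ using (ℕ; zero; suc; _+_; _*_; _≤_; _<_; _^_; z≤n; s≤s)
  import Data.Nat.Properties as ℕ
  open import Data.Bool using (Bool; true; false; T; not; _∧_)
  open import Data.List.Base as List using (List; []; _∷_; _++_; map; concatMap; length; allFin; filterᵇ; cartesianProductWith)
  open import Data.Bool.ListAction using (all)
  import Data.List.Properties as List
  open import Data.List.Membership.Propositional using (_∈_; find; lose)
  open import Data.List.Relation.Unary.Any as Any using (Any; here; there)
  import Data.List.Relation.Unary.All as All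
  import Data.List.Relation.Unary.All.Properties as All
  open import Data.List.Relation.Unary.Unique.Propositional using (Unique; []; _∷_)
  import Data.List.Membership.Propositional.Properties as ∈
  open import Data.Sum using (inj₁; inj₂)
  open import Data.Fin.Subset using (Subset; inside; outside; ⊥; ∣_∣) renaming (_∈_ to _∈ₛ_)
  import Data.Fin.Subset.Properties as Subset
  open import Relation.Nullary using (contradiction; yes; no)
  open import Relation.Binary.Definitions using (DecidableEquality; Reflexive)
  open import Data.Fin using (Fin; zero; suc)
  open import Data.Vec.Base as Vec using (Vec; []; _∷_; _[_]≔_; lookup)
  import Data.Vec.Properties as Vec
  import Data.List.Relation.Unary.Unique.Propositional.Properties as Unique
  open import Data.Product using (_,_)
  open import Function using (_∘_)
  open import Relation.Binary.PropositionalEquality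
  open import Algebra.Properties.CommutativeSemigroup ℕ.+-commutativeSemigroup
    using () renaming (interchange to +-interchange)

  private variable
    a b : Level
    A : Set a
    B : Set b

  ∑ : List A → (A → ℕ) → ℕ
  ∑ []       f = 0
  ∑ (x ∷ xs) f = f x + ∑ xs f

  syntax ∑ xs (λ x → e) = ∑[ x ∈ xs ] e

  𝟙 : Bool → ℕ
  𝟙 true  = 1
  𝟙 false = 0

  ∑-cong : ∀ (xs : List A) {f g} → (∀ x → f x ≡ g x) → ∑ xs f ≡ ∑ xs g
  ∑-cong []       f≗g = refl
  ∑-cong (x ∷ xs) f≗g = cong₂ _+_ (f≗g x) (∑-cong xs f≗g)

  ∑-mono-≤ : ∀ (xs : List A) {f g} → (∀ {x} → x ∈ xs → f x ≤ g x) → ∑ xs f ≤ ∑ xs g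
  ∑-mono-≤ []       f≤g = z≤n
  ∑-mono-≤ (x ∷ xs) f≤g = ℕ.+-mono-≤ (f≤g (here refl)) (∑-mono-≤ xs (f≤g ∘ there))

  ∑-distrib-+ : ∀ (xs : List A) f g → ∑[ x ∈ xs ] (f x + g x) ≡ ∑ xs f + ∑ xs g
  ∑-distrib-+ []       f g = refl
  ∑-distrib-+ (x ∷ xs) f g = trans (cong (f x + g x +_) (∑-distrib-+ xs f g))
                                   (+-interchange (f x) (g x) (∑ xs f) (∑ xs g))

  *-distribˡ-∑ : ∀ c (xs : List A) f → c * ∑ xs f ≡ ∑[ x ∈ xs ] (c * f x)
  *-distribˡ-∑ c []       f = ℕ.*-zeroʳ c
  *-distribˡ-∑ c (x ∷ xs) f = trans (ℕ.*-distribˡ-+ c (f x) _) (cong (c * f x +_) (*-distribˡ-∑ c xs f))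

  ∑-const : ∀ (xs : List A) c → ∑[ _ ∈ xs ] c ≡ length xs * c
  ∑-const []       c = refl
  ∑-const (x ∷ xs) c = cong (c +_) (∑-const xs c)

  ∑-++ : ∀ (xs ys : List A) f → ∑ (xs ++ ys) f ≡ ∑ xs f + ∑ ys f
  ∑-++ []       ys f = refl
  ∑-++ (x ∷ xs) ys f = trans (cong (f x +_) (∑-++ xs ys f)) (sym (ℕ.+-assoc (f x) _ _))

  ∑-map : ∀ (g : A → B) (xs : List A) f → ∑ (map g xs) f ≡ ∑ xs (f ∘ g)
  ∑-map g []       f = refl
  ∑-map g (x ∷ xs) f = cong (f (g x) +_) (∑-map g xs f)

  ∑-comm : ∀ (xs : List A) (ys : List B) (f : A → B → ℕ) →
    ∑[ x ∈ xs ] ∑[ y ∈ ys ] f x y ≡ ∑[ y ∈ ys ] ∑[ x ∈ xs ] f x y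
  ∑-comm []       ys f = sym (trans (∑-const ys 0) (ℕ.*-zeroʳ (length ys)))
  ∑-comm (x ∷ xs) ys f = trans (cong (∑ ys (f x) +_) (∑-comm xs ys f))
                               (sym (∑-distrib-+ ys (f x) (λ y → ∑[ x′ ∈ xs ] f x′ y)))

  ∑-cartesianProductWith : ∀ {c} {C : Set c} (g : A → B → C) xs ys f →
    ∑ (cartesianProductWith g xs ys) f ≡ ∑[ x ∈ xs ] ∑[ y ∈ ys ] f (g x y)
  ∑-cartesianProductWith g []       ys f = refl
  ∑-cartesianProductWith g (x ∷ xs) ys f =
    trans (∑-++ (map (g x) ys) _ f) (cong₂ _+_ (∑-map (g x) ys f) (∑-cartesianProductWith g xs ys f))

  ∑-allFin-suc : ∀ {n} f → ∑ (allFin (suc n)) f ≡ f zero + ∑ (allFin n) (f ∘ suc)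
  ∑-allFin-suc {n} f = cong (f zero +_) (begin
    ∑ (List.tabulate suc) f       ≡⟨ cong (λ xs → ∑ xs f) (List.map-tabulate (λ i → i) suc) ⟨
    ∑ (map suc (allFin n)) f      ≡⟨ ∑-map suc (allFin n) f ⟩
    ∑ (allFin n) (f ∘ suc)        ∎)
    where open ≡-Reasoning

  length≡∑𝟙-filterᵇ : ∀ (p : A → Bool) xs → length (filterᵇ p xs) ≡ ∑[ x ∈ xs ] 𝟙 (p x)
  length≡∑𝟙-filterᵇ p []       = refl
  length≡∑𝟙-filterᵇ p (x ∷ xs) with p x
  ... | true  = cong suc (length≡∑𝟙-filterᵇ p xs)
  ... | false = length≡∑𝟙-filterᵇ p xs

  𝟙-not-all≤∑ : ∀ (p : A → Bool) xs → 𝟙 (not (all p xs)) ≤ ∑[ x ∈ xs ] 𝟙 (not (p x))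
  𝟙-not-all≤∑ p []       = z≤n
  𝟙-not-all≤∑ p (x ∷ xs) with p x
  ... | true  = 𝟙-not-all≤∑ p xs
  ... | false = s≤s z≤n

  𝟙+𝟙-not : ∀ b → 𝟙 b + 𝟙 (not b) ≡ 1
  𝟙+𝟙-not true  = refl
  𝟙+𝟙-not false = refl

  ∑𝟙+∑𝟙-not : ∀ (p : A → Bool) xs → (∑[ x ∈ xs ] 𝟙 (p x)) + (∑[ x ∈ xs ] 𝟙 (not (p x))) ≡ length xs
  ∑𝟙+∑𝟙-not p xs = begin
    (∑[ x ∈ xs ] 𝟙 (p x)) + (∑[ x ∈ xs ] 𝟙 (not (p x))) ≡⟨ ∑-distrib-+ xs _ _ ⟨
    (∑[ x ∈ xs ] (𝟙 (p x) + 𝟙 (not (p x))))          ≡⟨ ∑-cong xs (𝟙+𝟙-not ∘ p) ⟩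
    (∑[ x ∈ xs ] 1)                                  ≡⟨ ∑-const xs 1 ⟩
    length xs * 1                                  ≡⟨ ℕ.*-identityʳ (length xs) ⟩
    length xs                                      ∎
    where open ≡-Reasoning

  markov : ∀ (xs : List A) f B → B * (∑[ x ∈ xs ] 𝟙 (not (f x ℕ.≤ᵇ B))) ≤ ∑ xs f
  markov xs f B = begin
    B * (∑[ x ∈ xs ] 𝟙 (not (f x ℕ.≤ᵇ B)))   ≡⟨ *-distribˡ-∑ B xs _ ⟩
    (∑[ x ∈ xs ] (B * 𝟙 (not (f x ℕ.≤ᵇ B))))   ≤⟨ ∑-mono-≤ xs (λ {x} _ → pointwise x) ⟩
    ∑ xs f                                 ∎
    where
    open ℕ.≤-Reasoning
    pointwise : ∀ x → B * 𝟙 (not (f x ℕ.≤ᵇ B)) ≤ f x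
    pointwise x with f x ℕ.≤ᵇ B in eq
    ... | true  = ℕ.≤-trans (ℕ.≤-reflexive (ℕ.*-zeroʳ B)) z≤n
    ... | false = ℕ.≤-trans (ℕ.≤-reflexive (ℕ.*-identityʳ B))
                    (ℕ.<⇒≤ (ℕ.≰⇒> λ fx≤B → subst T eq (ℕ.≤⇒≤ᵇ fx≤B)))

  𝟙-∧-cover : ∀ x y → 1 ≤ 𝟙 (x ∧ y) + (𝟙 (not x) + 𝟙 (not y))
  𝟙-∧-cover true  true  = s≤s z≤n
  𝟙-∧-cover true  false = s≤s z≤n
  𝟙-∧-cover false y     = s≤s z≤n

  nonempty-cover : ∀ {a b ℓ} {X : Set a} {Y : Set b} {R : X → Y → Set ℓ} {xs : List X} {ys : List Y} →
    0 < length xs → (∀ x → x ∈ xs → Any (R x) ys) → 0 < length ys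
  nonempty-cover {xs = x ∷ _} _ cover with cover x (Any.here refl)
  ... | Any.here  _ = s≤s z≤n
  ... | Any.there _ = s≤s z≤n

  ≗-lookup⇒≡ : ∀ {a} {X : Set a} {k} (u v : Vec X k) → (∀ j → lookup u j ≡ lookup v j) → u ≡ v
  ≗-lookup⇒≡ u v u≗v = trans (sym (Vec.tabulate∘lookup u)) (trans (Vec.tabulate-cong u≗v) (Vec.tabulate∘lookup v))

  Unique⇒length≤ : ∀ {xs ys : List A} → Unique xs → (∀ {x} → x ∈ xs → x ∈ ys) → length xs ≤ length ys
  Unique⇒length≤ {xs = []}     _            _    = z≤n
  Unique⇒length≤ {xs = x ∷ xs} (x∉xs ∷ !xs) xs⊆ys
    with ys₁ , ys₂ , refl ← ∈.∈-∃++ (xs⊆ys (here refl)) = begin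
      suc (length xs)                 ≤⟨ s≤s (Unique⇒length≤ !xs xs⊆ys₁ys₂) ⟩
      suc (length (ys₁ ++ ys₂))       ≡⟨ List.length-++-sucʳ ys₁ x ys₂ ⟨
      length (ys₁ ++ x ∷ ys₂)         ∎
    where
    open ℕ.≤-Reasoning
    xs⊆ys₁ys₂ : ∀ {y} → y ∈ xs → y ∈ ys₁ ++ ys₂
    xs⊆ys₁ys₂ {y} y∈xs with ∈.∈-++⁻ ys₁ (xs⊆ys (there y∈xs))
    ... | inj₁ y∈ys₁         = ∈.∈-++⁺ˡ y∈ys₁
    ... | inj₂ (here refl)   = contradiction refl (All.lookup x∉xs y∈xs)
    ... | inj₂ (there y∈ys₂) = ∈.∈-++⁺ʳ ys₁ y∈ys₂

  Unique-map⁺ : ∀ {f : A → B} {xs} → (∀ {x y} → x ∈ xs → y ∈ xs → f x ≡ f y → x ≡ y) →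
                Unique xs → Unique (map f xs)
  Unique-map⁺ {xs = []}     _   []           = []
  Unique-map⁺ {xs = x ∷ xs} inj (x∉xs ∷ !xs) =
    All.map⁺ (All.tabulate λ y∈xs fx≡fy → All.lookup x∉xs y∈xs (inj (here refl) (there y∈xs) fx≡fy))
    ∷ Unique-map⁺ (λ x∈ y∈ → inj (there x∈) (there y∈)) !xs

  length-cartesianProductWith : ∀ {c} {C : Set c} (g : A → B → C) xs ys →
    length (cartesianProductWith g xs ys) ≡ length xs * length ys
  length-cartesianProductWith g []       ys = refl
  length-cartesianProductWith g (x ∷ xs) ys = begin
    length (map (g x) ys ++ cartesianProductWith g xs ys)       ≡⟨ List.length-++ (map (g x) ys) ⟩
    length (map (g x) ys) + length (cartesianProductWith g xs ys)
      ≡⟨ cong₂ _+_ (List.length-map (g x) ys) (length-cartesianProductWith g xs ys) ⟩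
    length ys + length xs * length ys                            ∎
    where open ≡-Reasoning

  length-allFin : ∀ n → length (allFin n) ≡ n
  length-allFin n = List.length-tabulate (λ i → i)

  ∑-allFin-const : ∀ n c → ∑[ _ ∈ allFin n ] c ≡ n * c
  ∑-allFin-const n c = trans (∑-const (allFin n) c) (cong (_* c) (length-allFin n))

  allVec : ∀ n k → List (Vec (Fin n) k)
  allVec n zero    = [] ∷ []
  allVec n (suc k) = cartesianProductWith _∷_ (allFin n) (allVec n k)

  ∈-allVec : ∀ {n k} (v : Vec (Fin n) k) → v ∈ allVec n k
  ∈-allVec []      = here refl
  ∈-allVec (x ∷ v) = ∈.∈-cartesianProductWith⁺ _∷_ (∈.∈-allFin x) (∈-allVec v)

  allVec-Unique : ∀ n k → Unique (allVec n k)
  allVec-Unique n zero    = All.[] ∷ []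
  allVec-Unique n (suc k) = Unique.cartesianProductWith⁺ _∷_ Vec.∷-injective (Unique.allFin⁺ n) (allVec-Unique n k)

  length-allVec : ∀ n k → length (allVec n k) ≡ n ^ k
  length-allVec n zero    = refl
  length-allVec n (suc k) = trans (length-cartesianProductWith _∷_ (allFin n) (allVec n k))
                                  (cong₂ _*_ (length-allFin n) (length-allVec n k))

  ∑-allVec-suc : ∀ {n k} f → ∑ (allVec n (suc k)) f ≡ ∑[ a ∈ allFin n ] ∑[ v ∈ allVec n k ] f (a ∷ v)
  ∑-allVec-suc {n} {k} f = ∑-cartesianProductWith _∷_ (allFin n) (allVec n k) f

  ∑-allVec-update : ∀ {n k} (j : Fin k) f →
    ∑[ a ∈ allFin n ] ∑[ b ∈ allVec n k ] f (b [ j ]≔ a) ≡ n * ∑ (allVec n k) f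
  ∑-allVec-update {n} {suc k} zero f = begin
    ∑[ a ∈ allFin n ] ∑[ b ∈ allVec n (suc k) ] f (b [ zero ]≔ a)
      ≡⟨ ∑-cong (allFin n) (λ a → ∑-allVec-suc (λ b → f (b [ zero ]≔ a))) ⟩
    ∑[ a ∈ allFin n ] ∑[ _ ∈ allFin n ] ∑[ v ∈ allVec n k ] f (a ∷ v)
      ≡⟨ ∑-cong (allFin n) (λ a → ∑-allFin-const n _) ⟩
    ∑[ a ∈ allFin n ] (n * ∑[ v ∈ allVec n k ] f (a ∷ v))
      ≡⟨ *-distribˡ-∑ n (allFin n) _ ⟨
    n * (∑[ a ∈ allFin n ] ∑[ v ∈ allVec n k ] f (a ∷ v))
      ≡⟨ cong (n *_) (∑-allVec-suc f) ⟨
    n * ∑ (allVec n (suc k)) f ∎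
    where open ≡-Reasoning
  ∑-allVec-update {n} {suc k} (suc j) f = begin
    ∑[ a ∈ allFin n ] ∑[ b ∈ allVec n (suc k) ] f (b [ suc j ]≔ a)
      ≡⟨ ∑-cong (allFin n) (λ a → ∑-allVec-suc (λ b → f (b [ suc j ]≔ a))) ⟩
    ∑[ a ∈ allFin n ] ∑[ x ∈ allFin n ] ∑[ v ∈ allVec n k ] f (x ∷ (v [ j ]≔ a))
      ≡⟨ ∑-comm (allFin n) (allFin n) _ ⟩
    ∑[ x ∈ allFin n ] ∑[ a ∈ allFin n ] ∑[ v ∈ allVec n k ] f (x ∷ (v [ j ]≔ a))
      ≡⟨ ∑-cong (allFin n) (λ x → ∑-allVec-update j (λ v → f (x ∷ v))) ⟩
    ∑[ x ∈ allFin n ] (n * ∑[ v ∈ allVec n k ] f (x ∷ v))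
      ≡⟨ *-distribˡ-∑ n (allFin n) _ ⟨
    n * (∑[ x ∈ allFin n ] ∑[ v ∈ allVec n k ] f (x ∷ v))
      ≡⟨ cong (n *_) (∑-allVec-suc f) ⟨
    n * ∑ (allVec n (suc k)) f ∎
    where open ≡-Reasoning

  T-all-allFin⁻ : ∀ {k} (p : Fin k → Bool) → T (all p (allFin k)) → ∀ j → T (p j)
  T-all-allFin⁻ {k} p all-p j = All.lookup (All.all⁺ p (allFin k) all-p) (∈.∈-allFin j)

  T-all-allFin⁺ : ∀ {k} (p : Fin k → Bool) → (∀ j → T (p j)) → T (all p (allFin k))
  T-all-allFin⁺ {k} p p-holds = All.all⁻ p {allFin k} (All.tabulate λ {j} _ → p-holds j)

  takeᵇ : ∀ {n} → ℕ → (Fin n → Bool) → Subset n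
  takeᵇ         zero    p = ⊥
  takeᵇ {zero}  (suc k) p = []
  takeᵇ {suc n} (suc k) p with p zero
  ... | true  = inside  ∷ takeᵇ k (p ∘ suc)
  ... | false = outside ∷ takeᵇ (suc k) (p ∘ suc)

  ∣takeᵇ∣ : ∀ {n} k (p : Fin n → Bool) → k ≤ ∑[ x ∈ allFin n ] 𝟙 (p x) → ∣ takeᵇ k p ∣ ≡ k
  ∣takeᵇ∣ {n}     zero    p _ = Subset.∣⊥∣≡0 n
  ∣takeᵇ∣ {suc n} (suc k) p k<count with p zero | ∑-allFin-suc (𝟙 ∘ p)
  ... | true  | count≡ = cong suc (∣takeᵇ∣ k (p ∘ suc) (ℕ.≤-pred (subst (suc k ≤_) count≡ k<count)))
  ... | false | count≡ = ∣takeᵇ∣ (suc k) (p ∘ suc) (subst (suc k ≤_) count≡ k<count)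

  takeᵇ⊆ : ∀ {n} k (p : Fin n → Bool) {x} → x ∈ₛ takeᵇ k p → T (p x)
  takeᵇ⊆         zero    p x∈ = contradiction x∈ Subset.∉⊥
  takeᵇ⊆ {suc n} (suc k) p {x} x∈ with p zero in eq
  takeᵇ⊆ {suc n} (suc k) p {zero}  Vec.here       | true  = subst T (sym eq) _
  takeᵇ⊆ {suc n} (suc k) p {suc x} (Vec.there x∈) | true  = takeᵇ⊆ k (p ∘ suc) x∈
  takeᵇ⊆ {suc n} (suc k) p {suc x} (Vec.there x∈) | false = takeᵇ⊆ (suc k) (p ∘ suc) x∈

  length-concatMap : ∀ (f : A → List B) xs → length (concatMap f xs) ≡ ∑[ x ∈ xs ] length (f x)
  length-concatMap f []       = refl
  length-concatMap f (x ∷ xs) = trans (List.length-++ (f x)) (cong (length (f x) +_) (length-concatMap f xs))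

  module GreedyPacking {r} {T : Set a} {Y : Set b} (_≟_ : DecidableEquality Y)
    (R : T → T → Set r) (R-refl : Reflexive R) (image : T → List Y) (image-Unique : ∀ t → Unique (image t))
    (overlap⇒R : ∀ t t′ {y} → y ∈ image t → y ∈ image t′ → R t t′) where

    open import Data.List.Membership.DecPropositional _≟_ using (_∈?_)

    record Packing (ts : List T) : Set (a ⊔ b ⊔ r) where
      field
        centres    : List T
        centres⊆ts : ∀ {t} → t ∈ centres → t ∈ ts
        disjoint   : Unique (concatMap image centres)
        covers     : ∀ {t} → t ∈ ts → Any (R t) centres

    greedy : ∀ ts → Packing ts
    greedy []       = record { centres = [] ; centres⊆ts = λ () ; disjoint = [] ; covers = λ () }
    greedy (t ∷ ts) with greedy ts
    ... | P with Any.any? (_∈? concatMap image (Packing.centres P)) (image t)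
    ...   | yes hit = record
      { centres    = centres
      ; centres⊆ts = there ∘ centres⊆ts
      ; disjoint   = disjoint
      ; covers     = λ { (here refl) → t-covered ; (there t∈) → covers t∈ }
      }
      where
      open Packing P
      t-covered : Any (R t) centres
      t-covered with y , y∈t , y∈rest ← find hit = Any.map (overlap⇒R t _ y∈t) (∈.∈-concatMap⁻ image y∈rest)
    ...   | no miss = record
      { centres    = t ∷ centres
      ; centres⊆ts = λ { (here refl) → here refl ; (there c∈) → there (centres⊆ts c∈) }
      ; disjoint   = Unique.++⁺ (image-Unique t) disjoint (λ (y∈t , y∈rest) → miss (lose y∈t y∈rest))
      ; covers     = λ { (here refl) → here R-refl ; (there t∈) → there (covers t∈) }
      }
      where open Packing P

    packing-size : ∀ {p q ts} → (∀ {t} → t ∈ ts → p ≤ q * length (image t)) → (P : Packing ts) →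
                   p * length (Packing.centres P) ≤ q * length (concatMap image (Packing.centres P))
    packing-size {p} {q} large P = begin
      p * length centres                        ≡⟨ ℕ.*-comm p _ ⟩
      length centres * p                        ≡⟨ ∑-const centres p ⟨
      (∑[ _ ∈ centres ] p)                      ≤⟨ ∑-mono-≤ centres (large ∘ centres⊆ts) ⟩
      (∑[ c ∈ centres ] (q * length (image c))) ≡⟨ *-distribˡ-∑ q centres _ ⟨
      q * (∑[ c ∈ centres ] length (image c))   ≡⟨ cong (q *_) (length-concatMap image centres) ⟨
      q * length (concatMap image centres)      ∎
      where
      open ℕ.≤-Reasoning
      open Packing P

module EdgeSums where

  open import Defs
  open import Algebra.Bundles using (AbelianGroup)
  open import Data.Nat using (zero; suc)
  open import Data.Fin using (Fin; zero; suc)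
  open import Data.Vec.Base using (Vec; _∷_; lookup; _[_]≔_)
  open import Relation.Binary.PropositionalEquality as ≡ using (_≡_)

  module _ {c ℓ} (G : AbelianGroup c ℓ) where
    open AbelianGroup G
    open import Algebra.Properties.CommutativeMonoid.Sum commutativeMonoid
      using (sum; sum-cong-≋; sum-replicate; ∑-distrib-+)
    open import Algebra.Definitions.RawMonoid rawMonoid using () renaming (_×_ to _·_)
    open import Algebra.Properties.Monoid.Mult monoid using (×-congʳ)
    open import Algebra.Properties.Group group using (∙-cancelˡ)
    open import Algebra.Solver.CommutativeMonoid commutativeMonoid using (solve; _⊜_; _⊕_)
    open import Relation.Binary.Reasoning.Setoid setoid

    gsum≡sum : ∀ {r} (f : Fin r → Carrier) → gsum G f ≡ sum f
    gsum≡sum {zero}  f = ≡.refl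
    gsum≡sum {suc r} f = ≡.cong (f zero ∙_) (gsum≡sum (λ i → f (suc i)))

    gsum-cong : ∀ {r} {f g : Fin r → Carrier} → (∀ j → f j ≈ g j) → gsum G f ≈ gsum G g
    gsum-cong {f = f} {g} f≈g = begin
      gsum G f ≡⟨ gsum≡sum f ⟩ sum f ≈⟨ sum-cong-≋ f≈g ⟩ sum g ≡⟨ gsum≡sum g ⟨ gsum G g ∎

    edgeSum : ∀ {n r} → (Fin r → Fin n → Carrier) → Vec (Fin n) r → Carrier
    edgeSum A b = gsum G (λ i → A i (lookup b i))

    edgeSum-update : ∀ {n r} (A : Fin r → Fin n → Carrier) b j a →
                     edgeSum A (b [ j ]≔ a) ∙ A j (lookup b j) ≈ edgeSum A b ∙ A j a
    edgeSum-update A (x ∷ b) zero    a =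
      solve 3 (λ p q s → (p ⊕ s) ⊕ q ⊜ (q ⊕ s) ⊕ p) refl (A zero a) (A zero x) (edgeSum (λ i → A (suc i)) b)
    edgeSum-update A (x ∷ b) (suc j) a = begin
      (A zero x ∙ edgeSum A′ (b [ j ]≔ a)) ∙ A (suc j) (lookup b j)  ≈⟨ assoc _ _ _ ⟩
      A zero x ∙ (edgeSum A′ (b [ j ]≔ a) ∙ A (suc j) (lookup b j))  ≈⟨ ∙-congˡ (edgeSum-update A′ b j a) ⟩
      A zero x ∙ (edgeSum A′ b ∙ A (suc j) a)                        ≈⟨ assoc _ _ _ ⟨
      (A zero x ∙ edgeSum A′ b) ∙ A (suc j) a                        ∎
      where A′ = λ i → A (suc i)

    module _ {n r} (A : Fin r → Fin n → Carrier) where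

      ∑-edgeSum-updates : ∀ b t →
        gsum G (λ j → edgeSum A (b [ j ]≔ lookup t j)) ∙ edgeSum A b ≈ r · edgeSum A b ∙ edgeSum A t
      ∑-edgeSum-updates b t = begin
        gsum G S[b←t] ∙ edgeSum A b                          ≡⟨ ≡.cong₂ _∙_ (gsum≡sum S[b←t]) (gsum≡sum Ab) ⟩
        sum S[b←t] ∙ sum Ab                                  ≈⟨ ∑-distrib-+ S[b←t] Ab ⟨
        sum (λ j → S[b←t] j ∙ Ab j)                          ≈⟨ sum-cong-≋ (λ j → edgeSum-update A b j (lookup t j)) ⟩
        sum (λ j → edgeSum A b ∙ At j)                       ≈⟨ ∑-distrib-+ (λ _ → edgeSum A b) At ⟩
        sum {r} (λ _ → edgeSum A b) ∙ sum At                 ≈⟨ ∙-cong (sum-replicate r) (reflexive (≡.sym (gsum≡sum At))) ⟩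
        r · edgeSum A b ∙ edgeSum A t                        ∎
        where
        S[b←t] Ab At : Fin r → Carrier
        S[b←t] j = edgeSum A (b [ j ]≔ lookup t j)
        Ab j = A j (lookup b j)
        At j = A j (lookup t j)

      edgeSum-updates-determine : ∀ b b′ t t′ → edgeSum A b ≈ edgeSum A b′ →
        (∀ j → edgeSum A (b [ j ]≔ lookup t j) ≈ edgeSum A (b′ [ j ]≔ lookup t′ j)) →
        edgeSum A t ≈ edgeSum A t′
      edgeSum-updates-determine b b′ t t′ b≈b′ updates≈ = ∙-cancelˡ (r · edgeSum A b) _ _ (begin
        r · edgeSum A b ∙ edgeSum A t                                 ≈⟨ ∑-edgeSum-updates b t ⟨
        gsum G (λ j → edgeSum A (b [ j ]≔ lookup t j)) ∙ edgeSum A b  ≈⟨ ∙-cong (gsum-cong updates≈) b≈b′ ⟩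
        gsum G (λ j → edgeSum A (b′ [ j ]≔ lookup t′ j)) ∙ edgeSum A b′ ≈⟨ ∑-edgeSum-updates b′ t′ ⟩
        r · edgeSum A b′ ∙ edgeSum A t′                               ≈⟨ ∙-congʳ (×-congʳ r (sym b≈b′)) ⟩
        r · edgeSum A b ∙ edgeSum A t′                                ∎)

      edgeSum-update-cancel : ∀ b b′ j a → edgeSum A b ≈ edgeSum A b′ →
        edgeSum A (b [ j ]≔ a) ≈ edgeSum A (b′ [ j ]≔ a) → A j (lookup b j) ≈ A j (lookup b′ j)
      edgeSum-update-cancel b b′ j a b≈b′ b[j]≈b′[j] = ∙-cancelˡ (edgeSum A (b [ j ]≔ a)) _ _ (begin
        edgeSum A (b [ j ]≔ a) ∙ A j (lookup b j)   ≈⟨ edgeSum-update A b j a ⟩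
        edgeSum A b ∙ A j a                         ≈⟨ ∙-congʳ b≈b′ ⟩
        edgeSum A b′ ∙ A j a                        ≈⟨ edgeSum-update A b′ j a ⟨
        edgeSum A (b′ [ j ]≔ a) ∙ A j (lookup b′ j) ≈⟨ ∙-congʳ b[j]≈b′[j] ⟨
        edgeSum A (b [ j ]≔ a) ∙ A j (lookup b′ j)  ∎)

module Hypergraph where

  open import Defs
  open Estimates
  open Counting
  open EdgeSums
  open import Data.Nat as ℕ using (ℕ; zero; suc; _+_; _*_; _≤_; _<_; _^_; z≤n; s≤s; NonZero)
  import Data.Nat.Properties as ℕ
  open import Data.Rational as ℚ using (ℚ; 1ℚ; _-_)
  open import Data.Bool using (Bool; T; T?; not; _∧_)
  open import Data.Bool.ListAction using (all)
  import Data.List.Properties as Listₚ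
  open import Data.List.Base as List using (List; _∷_; length; allFin; filterᵇ)
  open import Data.List.Membership.Propositional using (_∈_)
  open import Data.List.Relation.Unary.Any as Any using (Any)
  import Data.List.Relation.Unary.Any.Properties as Any
  open import Algebra.Bundles using (AbelianGroup)
  open import Data.List.Relation.Unary.Unique.Propositional using (Unique)
  import Data.List.Membership.Propositional.Properties as ∈
  import Data.List.Relation.Unary.Unique.Propositional.Properties as Unique
  open import Data.Fin as Fin using (Fin; zero; suc)
  open import Data.Vec.Base as Vec using (Vec; _∷_; lookup; _[_]≔_)
  import Data.Vec.Properties as Vec
  open import Data.Product using (∃; _×_; _,_; proj₂)
  open import Function using (_∘_; Equivalence)
  open import Data.Bool.Properties using (T-∧)
  open import Relation.Nullary.Decidable using (Dec; yes; no; isYes; toWitness; fromWitness)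
  open import Relation.Binary.PropositionalEquality
  open import Relation.Binary.Definitions using (DecidableEquality)
  open import Relation.Nullary using (contradiction)

  quarter-bound : ∀ X G M D → X ≤ G + (M + D) → 4 * M ≤ X → 4 * D ≤ X → X ≤ 2 * G
  quarter-bound X G M D X≤G+M+D 4M≤X 4D≤X = ℕ.*-cancelˡ-≤ 2 (ℕ.+-cancelʳ-≤ (2 * X) (2 * X) (2 * (2 * G)) (begin
    2 * X + 2 * X                ≡⟨ rearrange₁ X ⟩
    4 * X                        ≤⟨ ℕ.*-monoʳ-≤ 4 X≤G+M+D ⟩
    4 * (G + (M + D))            ≡⟨ rearrange₂ G M D ⟩
    4 * G + (4 * M + 4 * D)      ≤⟨ ℕ.+-monoʳ-≤ (4 * G) (ℕ.+-mono-≤ 4M≤X 4D≤X) ⟩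
    4 * G + (X + X)              ≡⟨ rearrange₃ G X ⟩
    2 * (2 * G) + 2 * X          ∎))
    where
    open ℕ.≤-Reasoning
    open import Data.Nat.Tactic.RingSolver using (solve-∀)
    rearrange₁ : ∀ X → 2 * X + 2 * X ≡ 4 * X
    rearrange₁ = solve-∀
    rearrange₂ : ∀ G M D → 4 * (G + (M + D)) ≡ 4 * G + (4 * M + 4 * D)
    rearrange₂ = solve-∀
    rearrange₃ : ∀ G X → 4 * G + (X + X) ≡ 2 * (2 * G) + 2 * X
    rearrange₃ = solve-∀

  module Dense {n r} (H : List (Vec (Fin n) r)) where

    Tuple : Set
    Tuple = Vec (Fin n) r

    total : ℕ
    total = n ^ r

    tuples : List Tuple
    tuples = allVec n r

    _≟ᵗ_ : DecidableEquality Tuple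
    _≟ᵗ_ = Vec.≡-dec Fin._≟_

    _∈H? : ∀ b → Dec (b ∈ H)
    b ∈H? = b ∈? H
      where open import Data.List.Membership.DecPropositional _≟ᵗ_ using (_∈?_)

    inH : Tuple → Bool
    inH b = isYes (b ∈H?)

    missing : ℕ
    missing = ∑[ b ∈ tuples ] 𝟙 (not (inH b))

    missingDeg : Fin r → Fin n → ℕ
    missingDeg j a = ∑[ b ∈ tuples ] 𝟙 (not (inH (b [ j ]≔ a)))

    typical : Fin r → Fin n → Bool
    typical j a = 4 * r * missingDeg j a ℕ.≤ᵇ total

    #typical #atypical : Fin r → ℕ
    #typical   j = ∑[ a ∈ allFin n ] 𝟙 (typical j a)
    #atypical  j = ∑[ a ∈ allFin n ] 𝟙 (not (typical j a))

    typicalTuple : Tuple → Bool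
    typicalTuple t = all (λ j → typical j (lookup t j)) (allFin r)

    anchor : Tuple → Tuple → Bool
    anchor t b = inH b ∧ all (λ j → inH (b [ j ]≔ lookup t j)) (allFin r)

    anchor⇒edges : ∀ t b → T (anchor t b) → T (inH b) × (∀ j → T (inH (b [ j ]≔ lookup t j)))
    anchor⇒edges t b t-anchor with b-edge , updates-edges ← Equivalence.to T-∧ t-anchor =
      b-edge , T-all-allFin⁻ (λ j → inH (b [ j ]≔ lookup t j)) updates-edges

    anchors : Tuple → List Tuple
    anchors t = filterᵇ (anchor t) tuples

    length-H+missing≡total : Unique H → length H + missing ≡ total
    length-H+missing≡total H-Unique = begin
      length H + missing                              ≡⟨ cong (_+ missing) (ℕ.≤-antisym H≤edges edges≤H) ⟩
      length edges + missing                          ≡⟨ cong (_+ missing) (length≡∑𝟙-filterᵇ inH tuples) ⟩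
      (∑[ b ∈ tuples ] 𝟙 (inH b)) + missing           ≡⟨ ∑𝟙+∑𝟙-not inH tuples ⟩
      length tuples                                   ≡⟨ length-allVec n r ⟩
      total                                           ∎
      where
      open ≡-Reasoning
      edges = filterᵇ inH tuples
      H≤edges : length H ≤ length edges
      H≤edges = Unique⇒length≤ {ys = edges} H-Unique
                  (λ {b} b∈H → ∈.∈-filter⁺ (T? ∘ inH) (∈-allVec b) (fromWitness {a? = b ∈H?} b∈H))
      edges≤H : length edges ≤ length H
      edges≤H = Unique⇒length≤ {ys = H} (Unique.filter⁺ (T? ∘ inH) (allVec-Unique n r))
                  (λ {b} b∈ → toWitness {a? = b ∈H?} (proj₂ (∈.∈-filter⁻ (T? ∘ inH) {xs = tuples} b∈)))

    #typical+#atypical : ∀ j → #typical j + #atypical j ≡ n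
    #typical+#atypical j = trans (∑𝟙+∑𝟙-not (typical j) (allFin n)) (length-allFin n)

    total*#atypical≤ : ∀ j → total * #atypical j ≤ n * (4 * r * missing)
    total*#atypical≤ j = begin
      total * #atypical j                               ≤⟨ markov (allFin n) (λ a → 4 * r * missingDeg j a) total ⟩
      (∑[ a ∈ allFin n ] (4 * r * missingDeg j a))      ≡⟨ *-distribˡ-∑ (4 * r) (allFin n) (missingDeg j) ⟨
      4 * r * (∑[ a ∈ allFin n ] missingDeg j a)        ≡⟨ cong (4 * r *_) (∑-allVec-update j (λ b → 𝟙 (not (inH b)))) ⟩
      4 * r * (n * missing)                             ≡⟨ x∙yz≈y∙xz (4 * r) n missing ⟩
      n * (4 * r * missing)                             ∎
      where
      open ℕ.≤-Reasoning
      open import Algebra.Properties.CommutativeSemigroup ℕ.*-commutativeSemigroup using (x∙yz≈y∙xz)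

    total≤anchors+missing+∑missingDeg : ∀ t →
      total ≤ length (anchors t) + (missing + ∑[ j ∈ allFin r ] missingDeg j (lookup t j))
    total≤anchors+missing+∑missingDeg t = begin
      total                                             ≡⟨ length-allVec n r ⟨
      length tuples                                     ≡⟨ trans (∑-const tuples 1) (ℕ.*-identityʳ (length tuples)) ⟨
      (∑[ b ∈ tuples ] 1)                               ≤⟨ ∑-mono-≤ tuples (λ {b} _ → covered b) ⟩
      (∑[ b ∈ tuples ] (𝟙 (anchor t b) + (𝟙 (not (inH b)) + ∑[ j ∈ allFin r ] 𝟙 (not (inH (b [ j ]≔ lookup t j))))))
        ≡⟨ ∑-distrib-+ tuples _ _ ⟩
      (∑[ b ∈ tuples ] 𝟙 (anchor t b)) + (∑[ b ∈ tuples ] (𝟙 (not (inH b)) + ∑[ j ∈ allFin r ] 𝟙 (not (inH (b [ j ]≔ lookup t j)))))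
        ≡⟨ cong₂ _+_ (sym (length≡∑𝟙-filterᵇ (anchor t) tuples)) (∑-distrib-+ tuples _ _) ⟩
      length (anchors t) + (missing + ∑[ b ∈ tuples ] ∑[ j ∈ allFin r ] 𝟙 (not (inH (b [ j ]≔ lookup t j))))
        ≡⟨ cong (λ d → length (anchors t) + (missing + d)) (∑-comm tuples (allFin r) _) ⟩
      length (anchors t) + (missing + ∑[ j ∈ allFin r ] missingDeg j (lookup t j)) ∎
      where
      open ℕ.≤-Reasoning
      covered : ∀ b → 1 ≤ 𝟙 (anchor t b) + (𝟙 (not (inH b)) + ∑[ j ∈ allFin r ] 𝟙 (not (inH (b [ j ]≔ lookup t j))))
      covered b = ℕ.≤-trans (𝟙-∧-cover (inH b) _) (ℕ.+-monoʳ-≤ (𝟙 (anchor t b))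
        (ℕ.+-monoʳ-≤ (𝟙 (not (inH b))) (𝟙-not-all≤∑ (λ j → inH (b [ j ]≔ lookup t j)) (allFin r))))

    many-anchors : .{{_ : NonZero r}} → 4 * r * missing ≤ total →
                   ∀ t → T (typicalTuple t) → total ≤ 2 * length (anchors t)
    many-anchors 4rM≤total t t-typical =
      quarter-bound total (length (anchors t)) missing D (total≤anchors+missing+∑missingDeg t) 4M≤total 4D≤total
      where
      open ℕ.≤-Reasoning
      D = ∑[ j ∈ allFin r ] missingDeg j (lookup t j)
      4M≤total : 4 * missing ≤ total
      4M≤total = ℕ.≤-trans (ℕ.*-monoˡ-≤ missing (ℕ.m≤m*n 4 r)) 4rM≤total
      4D≤total : 4 * D ≤ total
      4D≤total = ℕ.*-cancelˡ-≤ r (begin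
        r * (4 * D)                                    ≡⟨ rearrange r D ⟩
        4 * r * D                                      ≡⟨ *-distribˡ-∑ (4 * r) (allFin r) _ ⟩
        (∑[ j ∈ allFin r ] (4 * r * missingDeg j (lookup t j))) ≤⟨ ∑-mono-≤ (allFin r) (λ {j} _ → typical⇒ j) ⟩
        (∑[ j ∈ allFin r ] total)                      ≡⟨ ∑-allFin-const r total ⟩
        r * total                                      ∎)
        where
        open import Data.Nat.Tactic.RingSolver using (solve-∀)
        rearrange : ∀ r D → r * (4 * D) ≡ 4 * r * D
        rearrange = solve-∀
        typical⇒ : ∀ j → 4 * r * missingDeg j (lookup t j) ≤ total
        typical⇒ j = ℕ.≤ᵇ⇒≤ _ _ (T-all-allFin⁻ (λ j → typical j (lookup t j)) t-typical j)


    nonempty : .{{_ : NonZero n}} .{{_ : NonZero r}} → Unique H → 4 * r * missing ≤ total → 0 < length H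
    nonempty H-Unique 4rM≤total with length H | length-H+missing≡total H-Unique
    ... | suc _ | _             = s≤s z≤n
    ... | zero  | missing≡total = contradiction (begin-strict
      total             <⟨ ℕ.m<m*n total (4 * r) {{ℕ.m^n≢0 n r}} (ℕ.≤-trans (s≤s (s≤s z≤n)) (ℕ.m≤m*n 4 r)) ⟩
      total * (4 * r)   ≡⟨ ℕ.*-comm total (4 * r) ⟩
      4 * r * total     ≡⟨ cong (4 * r *_) missing≡total ⟨
      4 * r * missing   ≤⟨ 4rM≤total ⟩
      total             ∎) (ℕ.<-irrefl refl)
      where open ℕ.≤-Reasoning

    scaled-missing≤ε*total : ∀ {ε δ} .{{_ : NonZero r}} → Unique H →
      δ ℚ.≤ (ε /ℕ (4 * r)) {{ℕ.m*n≢0 4 r}} → (1ℚ - δ) ℚ.* (toℚ n ^ℚ r) ℚ.≤ toℚ (length H) →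
      toℚ (4 * r * missing) ℚ.≤ ε ℚ.* toℚ total
    scaled-missing≤ε*total {ε} {δ} H-Unique δ≤ε÷4r dense =
      c*m≤ε*x (4 * r) {{ℕ.m*n≢0 4 r}} {ε} {δ} total missing δ≤ε÷4r (rest≤δ*total {δ} total (length H) missing
        (subst (λ x → (1ℚ - δ) ℚ.* x ℚ.≤ toℚ (length H)) (sym (toℚ-homo-^ n r)) dense)
        (ℕ.≤-reflexive (length-H+missing≡total H-Unique)))

    many-typical : ∀ {ε k} .{{_ : NonZero n}} → toℚ (4 * r * missing) ℚ.≤ ε ℚ.* toℚ total →
      toℚ k ℚ.< (1ℚ - ε) ℚ.* toℚ n ℚ.+ 1ℚ → ∀ j → k ≤ #typical j
    many-typical {ε} {k} 4rM≤εX k<[1-ε]n+1 j = ℕ.+-cancelˡ-≤ (#atypical j) k (#typical j) (begin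
      #atypical j + k              ≤⟨ fraction+ceiling≤ {ε} n (#atypical j) k atypical≤εn k<[1-ε]n+1 ⟩
      n                            ≡⟨ #typical+#atypical j ⟨
      #typical j + #atypical j     ≡⟨ ℕ.+-comm (#typical j) (#atypical j) ⟩
      #atypical j + #typical j     ∎)
      where
      open ℕ.≤-Reasoning
      atypical≤εn : toℚ (#atypical j) ℚ.≤ ε ℚ.* toℚ n
      atypical≤εn = x*b≤n*l⇒b≤ε*n {ε} total n (#atypical j) _ {{ℕ.m^n≢0 n r}} (total*#atypical≤ j) 4rM≤εX

  module Signatures {c ℓ} (G : AbelianGroup c ℓ) {n r}
    (A : Fin r → Fin n → AbelianGroup.Carrier G) (A-injective : ∀ i x y → AbelianGroup._≈_ G (A i x) (A i y) → x ≡ y)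
    (H : List (Vec (Fin n) r)) (sums : List (AbelianGroup.Carrier G))
    (sums-cover : ∀ e → e ∈ H → Any (AbelianGroup._≈_ G (edgeSum G A e)) sums) (default : Fin (length sums)) where

    open AbelianGroup G using (Carrier; _≈_; reflexive) renaming (refl to ≈-refl; sym to ≈-sym; trans to ≈-trans)
    open Dense H

    -- Only codes of edges are ever compared, so the value for non-edges is irrelevant.
    code : Tuple → Fin (length sums)
    code b with b ∈H?
    ... | yes b∈H = Any.index (sums-cover b b∈H)
    ... | no  _   = default

    code-sound : ∀ b → T (inH b) → edgeSum G A b ≈ List.lookup sums (code b)
    code-sound b b-edge with b ∈H?
    ... | yes b∈H = Any.lookup-index (sums-cover b b∈H)

    code-≡⇒≈ : ∀ b b′ → T (inH b) → T (inH b′) → code b ≡ code b′ → edgeSum G A b ≈ edgeSum G A b′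
    code-≡⇒≈ b b′ b-edge b′-edge code≡ =
      ≈-trans (code-sound b b-edge) (≈-trans (reflexive (cong (List.lookup sums) code≡)) (≈-sym (code-sound b′ b′-edge)))

    Signature : Set
    Signature = Vec (Fin (length sums)) (suc r)

    signature : Tuple → Tuple → Signature
    signature t b = code b ∷ Vec.tabulate (λ j → code (b [ j ]≔ lookup t j))

    signature-codes : ∀ t t′ b b′ → signature t b ≡ signature t′ b′ →
      code b ≡ code b′ × (∀ j → code (b [ j ]≔ lookup t j) ≡ code (b′ [ j ]≔ lookup t′ j))
    signature-codes t t′ b b′ eq with code≡ , codes≡ ← Vec.∷-injective eq = code≡ , λ j → begin
      code (b [ j ]≔ lookup t j)      ≡⟨ Vec.lookup∘tabulate codes j ⟨
      lookup (Vec.tabulate codes) j   ≡⟨ cong (λ v → lookup v j) codes≡ ⟩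
      lookup (Vec.tabulate codes′) j  ≡⟨ Vec.lookup∘tabulate codes′ j ⟩
      code (b′ [ j ]≔ lookup t′ j)    ∎
      where
      open ≡-Reasoning
      codes codes′ : Fin r → Fin (length sums)
      codes  j = code (b [ j ]≔ lookup t j)
      codes′ j = code (b′ [ j ]≔ lookup t′ j)

    signature-injective : ∀ t b b′ → T (anchor t b) → T (anchor t b′) → signature t b ≡ signature t b′ → b ≡ b′
    signature-injective t b b′ b-anchor b′-anchor eq
      with b-edge , b-updates ← anchor⇒edges t b b-anchor
         | b′-edge , b′-updates ← anchor⇒edges t b′ b′-anchor
         | code≡ , codes≡ ← signature-codes t t b b′ eq = ≗-lookup⇒≡ b b′ λ j →
      A-injective j _ _ (edgeSum-update-cancel G A b b′ j (lookup t j)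
        (code-≡⇒≈ b b′ b-edge b′-edge code≡) (code-≡⇒≈ _ _ (b-updates j) (b′-updates j) (codes≡ j)))

    signature-determines-sum : ∀ t t′ b b′ → T (anchor t b) → T (anchor t′ b′) →
      signature t b ≡ signature t′ b′ → edgeSum G A t ≈ edgeSum G A t′
    signature-determines-sum t t′ b b′ b-anchor b′-anchor eq
      with b-edge , b-updates ← anchor⇒edges t b b-anchor
         | b′-edge , b′-updates ← anchor⇒edges t′ b′ b′-anchor
         | code≡ , codes≡ ← signature-codes t t′ b b′ eq = edgeSum-updates-determine G A b b′ t t′
      (code-≡⇒≈ b b′ b-edge b′-edge code≡) (λ j → code-≡⇒≈ _ _ (b-updates j) (b′-updates j) (codes≡ j))

    image : Tuple → List Signature
    image t = List.map (signature t) (anchors t)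

    ∈-anchors⇒anchor : ∀ t {b} → b ∈ anchors t → T (anchor t b)
    ∈-anchors⇒anchor t b∈ = proj₂ (∈.∈-filter⁻ (T? ∘ anchor t) {xs = tuples} b∈)

    image-Unique : ∀ t → Unique (image t)
    image-Unique t = Unique-map⁺
      (λ b∈ b′∈ → signature-injective t _ _ (∈-anchors⇒anchor t b∈) (∈-anchors⇒anchor t b′∈))
      (Unique.filter⁺ (T? ∘ anchor t) (allVec-Unique n r))

    image-overlap : ∀ t t′ {y} → y ∈ image t → y ∈ image t′ → edgeSum G A t ≈ edgeSum G A t′
    image-overlap t t′ y∈ y∈′
      with b , b∈ , refl ← ∈.∈-map⁻ (signature t) y∈
         | b′ , b′∈ , eq ← ∈.∈-map⁻ (signature t′) y∈′ =
      signature-determines-sum t t′ b b′ (∈-anchors⇒anchor t b∈) (∈-anchors⇒anchor t′ b′∈) eq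

    open GreedyPacking (Vec.≡-dec Fin._≟_) (λ t t′ → edgeSum G A t ≈ edgeSum G A t′) ≈-refl image image-Unique image-overlap

    typicalTuples : List Tuple
    typicalTuples = filterᵇ typicalTuple tuples

    open Packing (greedy typicalTuples) public

    centres-few : .{{_ : NonZero r}} → 4 * r * missing ≤ total → total * length centres ≤ 2 * length sums ^ suc r
    centres-few 4rM≤total = ℕ.≤-trans (packing-size {q = 2} large (greedy typicalTuples)) (ℕ.*-monoʳ-≤ 2 signatures-few)
      where
      large : ∀ {t} → t ∈ typicalTuples → total ≤ 2 * length (image t)
      large {t} t∈ = subst (λ l → total ≤ 2 * l) (sym (Listₚ.length-map (signature t) (anchors t)))
        (many-anchors 4rM≤total t (proj₂ (∈.∈-filter⁻ (T? ∘ typicalTuple) {xs = tuples} t∈)))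
      signatures-few : length (List.concatMap image centres) ≤ length sums ^ suc r
      signatures-few = ℕ.≤-trans (Unique⇒length≤ disjoint (λ {y} _ → ∈-allVec y))
                                 (ℕ.≤-reflexive (length-allVec (length sums) (suc r)))

    typical⇒covered : ∀ t → T (typicalTuple t) → Any (λ t′ → edgeSum G A t ≈ edgeSum G A t′) centres
    typical⇒covered t t-typical = covers (∈.∈-filter⁺ (T? ∘ typicalTuple) (∈-allVec t) t-typical)

  module _ {c ℓ} (G : AbelianGroup c ℓ) where
    open AbelianGroup G using (Carrier; _≈_) renaming (trans to ≈-trans)
    open import Data.Fin.Subset using (Subset; ∣_∣) renaming (_∈_ to _∈ₛ_)
    open import Data.List.Membership.Setoid (AbelianGroup.setoid G) using () renaming (_∈_ to _∈ᴳ_)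

    small-sumset : ∀ {n r} .{{_ : NonZero n}} .{{_ : NonZero r}} (A : Fin r → Fin n → Carrier) →
      (∀ i x y → A i x ≈ A i y → x ≡ y) →
      (H : List (Vec (Fin n) r)) → Unique H → (sums : List Carrier) → (∀ e → e ∈ H → Any (edgeSum G A e ≈_) sums) →
      4 * r * Dense.missing H ≤ n ^ r → ∀ k → (∀ j → k ≤ Dense.#typical H j) →
      ∃ λ (A′ : Fin r → Subset n) → (∀ i → ∣ A′ i ∣ ≡ k) × ∃ λ (m : ℕ) → n ^ r * m ≤ 2 * length sums ^ suc r ×
        AtMost G (λ x → ∃ λ (t : Fin r → Fin n) → (∀ i → t i ∈ₛ A′ i) × x ≈ gsum G (λ i → A i (t i))) m
    small-sumset {n} {r} A A-injective H H-Unique sums sums-cover 4rM≤total k k≤#typical =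
      A′ , (λ i → ∣takeᵇ∣ k (typical i) (k≤#typical i)) , length centres , centres-few 4rM≤total ,
      List.map (edgeSum G A) centres , ℕ.≤-reflexive (Listₚ.length-map (edgeSum G A) centres) , covered
      where
      open Dense H
      open Signatures G A A-injective H sums sums-cover (Fin.fromℕ< (nonempty-cover (nonempty H-Unique 4rM≤total) sums-cover))
      A′ : Fin r → Subset n
      A′ i = takeᵇ k (typical i)
      covered : ∀ x → (∃ λ (t : Fin r → Fin n) → (∀ i → t i ∈ₛ A′ i) × x ≈ gsum G (λ i → A i (t i))) →
                x ∈ᴳ List.map (edgeSum G A) centres
      covered x (t , t∈A′ , x≈) = Any.map⁺ (Any.map (≈-trans x≈t) (typical⇒covered (Vec.tabulate t) t-typical))
        where
        x≈t : x ≈ edgeSum G A (Vec.tabulate t)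
        x≈t = ≈-trans x≈ (gsum-cong G λ i → AbelianGroup.reflexive G (cong (A i) (sym (Vec.lookup∘tabulate t i))))
        t-typical : T (typicalTuple (Vec.tabulate t))
        t-typical = T-all-allFin⁺ _ λ j →
          subst (T ∘ typical j) (sym (Vec.lookup∘tabulate t j)) (takeᵇ⊆ k (typical j) (t∈A′ j))

open import Defs
open import Data.Nat as ℕ using (ℕ; zero; suc; _∸_; s≤s; z≤n)
import Data.Nat.Properties as ℕ
open import Data.Integer using (+_)
open import Data.Rational using (ℚ; 0ℚ; 1ℚ; _<_; _≤_; _*_; _-_; ceiling)
import Data.Rational.Properties as ℚ
open import Data.Fin using (Fin)
open import Data.Fin.Subset using (Subset; ∣_∣; _∈_)
open import Data.Vec using (Vec; lookup)
open import Data.List using (List; length)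
open import Data.List.Relation.Unary.Unique.Propositional using (Unique)
open import Data.List.Membership.Propositional using () renaming (_∈_ to _∈ˡ_)
open import Data.Product using (∃; _×_; _,_)
open import Relation.Binary.PropositionalEquality using (_≡_; trans; cong)
open import Algebra.Bundles using (AbelianGroup)

open Estimates
open Counting
open EdgeSums
open Hypergraph

1+r≤2r∸1 : ∀ {r} → 2 ℕ.≤ r → suc r ℕ.≤ 2 ℕ.* r ∸ 1
1+r≤2r∸1 {suc (suc q)} (s≤s (s≤s z≤n)) =
  s≤s (ℕ.≤-trans (ℕ.m≤n+m (suc (suc q)) q) (ℕ.+-monoʳ-≤ q (s≤s (s≤s (ℕ.m≤m+n q 0)))))

lemma4p1 : ∀ {c ℓ} (r : ℕ) → 2 ℕ.≤ r → (C ε : ℚ) → 1ℚ < C → 0ℚ < ε → ε < 1ℚ →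
  ∃ λ (δ₀ : ℚ) → 0ℚ < δ₀ × ∃ λ (n₀ : ℕ) →
  ∀ (δ : ℚ) → 0ℚ < δ → δ ≤ δ₀ → ∀ (n : ℕ) → n₀ ℕ.≤ n →
  (G : AbelianGroup c ℓ) →
  (A : Fin r → Fin n → AbelianGroup.Carrier G) →
  (∀ i x y → AbelianGroup._≈_ G (A i x) (A i y) → x ≡ y) →
  (H : List (Vec (Fin n) r)) → Unique H →
  (1ℚ - δ) * (toℚ n ^ℚ r) ≤ toℚ (length H) →
  (∃ λ (m : ℕ) → toℚ m ≤ C * toℚ n ×
    AtMost G (λ x → ∃ λ (e : Vec (Fin n) r) → e ∈ˡ H ×
      AbelianGroup._≈_ G x (gsum G (λ i → A i (lookup e i)))) m) →
  ∃ λ (A′ : Fin r → Subset n) →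
    (∀ i → + ∣ A′ i ∣ ≡ ⌈ (1ℚ - ε) * toℚ n ⌉) ×
    ∃ λ (m : ℕ) → toℚ m ≤ toℚ 2 * (C ^ℚ (2 ℕ.* r ∸ 1)) * toℚ n ×
      AtMost G (λ x → ∃ λ (t : Fin r → Fin n) → (∀ i → t i ∈ A′ i) ×
        AbelianGroup._≈_ G x (gsum G (λ i → A i (t i)))) m
lemma4p1 r 2≤r@(s≤s (s≤s z≤n)) C ε 1<C 0<ε ε<1 = ε /ℕ (4 ℕ.* r) , 0</ℕ {ε} (4 ℕ.* r) 0<ε , 1 , λ where
  δ _ δ≤δ₀ n (s≤s z≤n) G A A-injective H H-Unique dense (m , m≤Cn , sums , |sums|≤m , sums-cover) →
    let open Dense H
        4rM≤εX = scaled-missing≤ε*total {ε} {δ} H-Unique δ≤δ₀ dense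
        k , k≡⌈⌉ , k<[1-ε]n+1 = ceiling-nonNeg ((1ℚ - ε) * toℚ n) (0≤[1-ε]*toℚ n (ℚ.<⇒≤ ε<1))
        A′ , |A′|≡k , K , K-few , K-covers = small-sumset G A A-injective H H-Unique sums
          (λ e e∈H → sums-cover _ (e , e∈H , AbelianGroup.refl G))
          (toℚ≤ε*toℚ⇒≤ {ε} _ _ (ℚ.<⇒≤ ε<1) 4rM≤εX) k (many-typical {ε} 4rM≤εX k<[1-ε]n+1)
    in A′ , (λ i → trans (cong +_ (|A′|≡k i)) k≡⌈⌉) , K ,
       power-count-bound r (2 ℕ.* r ∸ 1) n (length sums) K (ℚ.<⇒≤ 1<C) (1+r≤2r∸1 2≤r) K-few
         (ℚ.≤-trans (toℚ-mono-≤ |sums|≤m) m≤Cn) ,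
       K-covers
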